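{- $a_1a_2a_3=\mathrm{id}$ in $W$ (equivalently, its restriction to $T_n$ is the identity for all $n\geq 1$).
   Context: Let $T$ be the infinite rooted binary tree whose vertices are finite words over $\{1,2\}$ (the children of $w$ are $w1,w2$), $T_n$ the subtree of words of length $\le n$, $W=\mathrm{Aut}(T)$. For $u,v\in W$, $(u,v)\in W$ is the automorphism $1w\mapsto 1u(w)$, $2w\mapsto 2v(w)$; $\sigma\in W$ swaps the first letter and fixes the rest; $(u,v)\sigma$ denotes the composition $(u,v)\circ\sigma$ (maps compose right to left), so that $(x_1,x_2)\tau(y_1,y_2)\tau'=(x_1y_{\tau(1)},x_2y_{\tau(2)})\tau\tau'$. The elements $a_1,a_2,a_3\in W$ are the unique elements satisfying $a_1=(\mathrm{id},a_3)$, $a_2=(\mathrm{id},a_1)\sigma$, $a_3=(a_2,\mathrm{id})\sigma$. -}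

module Defs where

open import Data.List using (List; []; _∷_)
open import Function using (_∘_)

-- Alphabet {1,2} and vertices of T (finite words)
data Letter : Set where
  l1 l2 : Letter

Word : Set
Word = List Letter

-- a1 = (id, a3),  a2 = (id, a1) σ,  a3 = (a2, id) σ
-- unfolded on words (composition right to left, σ swaps the first letter):
--   a1 (1w) = 1w,      a1 (2w) = 2 a3(w)
--   a2 (1w) = 2 a1(w), a2 (2w) = 1w
--   a3 (1w) = 2w,      a3 (2w) = 1 a2(w)
-- all fix the empty word.
a1 a2 a3 : Word → Word
a1 []        = []
a1 (l1 ∷ w)  = l1 ∷ w
a1 (l2 ∷ w)  = l2 ∷ a3 w
a2 []        = []
a2 (l1 ∷ w)  = l2 ∷ a1 w
a2 (l2 ∷ w)  = l1 ∷ w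
a3 []        = []
a3 (l1 ∷ w)  = l2 ∷ w
a3 (l2 ∷ w)  = l1 ∷ a2 w

a1a2a3 : Word → Word
a1a2a3 = a1 ∘ a2 ∘ a3

-- In wreath-recursion notation the three cyclic rotations of the product satisfy
--   a1 a2 a3 = (id, a3 a1 a2),   a3 a1 a2 = (a2 a3 a1, id),   a2 a3 a1 = (id, a1 a2 a3),
-- so each rotation acts on a word as the next rotation does on its tail, and all three
-- are the identity by simultaneous induction on the length of the word.
module Submission where

open import Defs
open import Data.List using ([]; _∷_)
open import Function using (_∘_; id)
open import Relation.Binary.PropositionalEquality using (_≡_; _≗_; refl; cong)

a1∘a2∘a3≗id : a1 ∘ a2 ∘ a3 ≗ id
a2∘a3∘a1≗id : a2 ∘ a3 ∘ a1 ≗ id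
a3∘a1∘a2≗id : a3 ∘ a1 ∘ a2 ≗ id

a1∘a2∘a3≗id []       = refl
a1∘a2∘a3≗id (l1 ∷ w) = refl
a1∘a2∘a3≗id (l2 ∷ w) = cong (l2 ∷_) (a3∘a1∘a2≗id w)

a2∘a3∘a1≗id []       = refl
a2∘a3∘a1≗id (l1 ∷ w) = refl
a2∘a3∘a1≗id (l2 ∷ w) = cong (l2 ∷_) (a1∘a2∘a3≗id w)

a3∘a1∘a2≗id []       = refl
a3∘a1∘a2≗id (l1 ∷ w) = cong (l1 ∷_) (a2∘a3∘a1≗id w)
a3∘a1∘a2≗id (l2 ∷ w) = refl

lemma3p2 : (w : Word) → a1a2a3 w ≡ w
lemma3p2 = a1∘a2∘a3≗id
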